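{- Let $p$ be a prime, $n\geq 1$, and $F:\mathbb{F}_{p^n}\rightarrow \mathbb{F}_{p^n}$. Let $\alpha\in\mathbb{F}_{p^n}$. Then for all $x\in\mathbb{F}_{p^n}$, \[\Delta_{\underbrace{\alpha,\alpha,\dots,\alpha}_{p-1}} F(x)= -\Delta_{\alpha,2\alpha,\dots,(p-1)\alpha} F(x).\]
   Context: For $F:\mathbb{F}_{q}\rightarrow\mathbb{F}_{q}$ and $\alpha\in\mathbb{F}_q$, the (first-order) derivative is $\Delta_\alpha F(x)=F(x+\alpha)-F(x)$. For directions $\alpha_1,\dots,\alpha_d\in\mathbb{F}_q$ (repetitions allowed), the $d$-th order derivative is defined recursively by $\Delta_{\alpha_1,\dots,\alpha_d}F=\Delta_{\alpha_1}\Delta_{\alpha_2,\dots,\alpha_d}F$, equivalently \[\Delta_{\alpha_1,\dots,\alpha_d} F(x) = \sum_{j=0}^{d} (-1)^{d-j} \sum_{\{i_1,\dots,i_j\}\subseteq \{1,\dots,d\}} F\Big(x + \sum_{k=1}^j \alpha_{i_k}\Big).\] Here $\iota\alpha$ for $\iota\in\{1,\dots,p-1\}$ denotes the $\iota$-fold sum of $\alpha$. -}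

module Defs where

open import Level using (Level; _⊔_)
open import Data.Nat using (ℕ; zero; suc; _^_)
open import Data.Fin using (Fin)
open import Data.List using (List; []; _∷_)
open import Data.Product using (∃; Σ)
open import Relation.Binary.PropositionalEquality using (_≡_)
open import Relation.Nullary using (¬_)
open import Algebra.Bundles using (CommutativeRing)

record IsField {c ℓ : Level} (R : CommutativeRing c ℓ) : Set (c ⊔ ℓ) where
  open CommutativeRing R
  field
    1≉0     : ¬ (1# ≈ 0#)
    inverse : ∀ x → ¬ (x ≈ 0#) → ∃ λ y → (x * y) ≈ 1#

record HasCardinality {c ℓ : Level} (R : CommutativeRing c ℓ) (m : ℕ) : Set (c ⊔ ℓ) where
  open CommutativeRing R
  field
    enum       : Fin m → Carrier
    enum-inj   : ∀ i j → enum i ≈ enum j → i ≡ j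
    enum-surj  : ∀ x → ∃ λ i → enum i ≈ x

module _ {c ℓ : Level} (R : CommutativeRing c ℓ) where
  open CommutativeRing R

  _·_ : ℕ → Carrier → Carrier
  zero  · a = 0#
  suc i · a = a + (i · a)

  Δ : List Carrier → (Carrier → Carrier) → Carrier → Carrier
  Δ []       F x = F x
  Δ (a ∷ as) F x = Δ as F (x + a) - Δ as F x

{-# OPTIONS --safe #-}
module Submission where

-- Write D for the difference operator along α. Summing over the field, which translation
-- by x permutes, gives p ^ n · x = 0, so the characteristic is p. The coefficients of
-- (X - 1) ^ p then vanish except at X ^ 0 and X ^ p, and p α = 0, so D ^ p annihilates
-- every function: D ^ (p - 1) F is α-periodic. For a function G whose increment along α
-- is periodic, telescoping gives Δ_{jα} G = j · Δ_α G, and since difference operators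
-- commute, Δ_{α,2α,…,(p-1)α} F = (p - 1)! · D ^ (p - 1) F. Wilson's theorem
-- (p - 1)! = -1, obtained by pairing each of 2, …, p - 2 with its inverse modulo p,
-- gives the sign.

open import Defs
open import Level using (Level; _⊔_)
open import Data.Nat as ℕ using (ℕ; zero; suc; _^_; _≥_; _∸_; _<_; _≤_; z≤n; s≤s; _!)
import Data.Nat.Properties as ℕ
open import Data.Nat.DivMod using (_%_; _/_; m%n<n; m≡m%n+[m/n]*n)
open import Data.Nat.Primality using (Prime; prime⇒nonZero; prime⇒nonTrivial)
open import Data.Nat.Coprimality using (prime⇒coprime; coprime-Bézout)
open import Data.Nat.GCD using (module Bézout)
open import Data.Nat.ListAction using (product)
open import Data.Nat.ListAction.Properties using (product-↭)
open import Data.Fin as Fin using (Fin; toℕ)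
open import Data.Fin.Properties using (toℕ<n)
open import Data.Fin.Permutation using (Permutation; permutation)
open import Data.List using (List; []; _∷_; _++_; replicate; map; foldr; length; upTo; applyUpTo; applyDownFrom)
open import Data.List.Properties using (map-cong; map-upTo; map-applyUpTo; length-applyUpTo; reverse-applyUpTo)
open import Data.List.Membership.Propositional using (_∈_; _∉_)
open import Data.List.Membership.Propositional.Properties
  using (∈-++⁺ˡ; ∈-++⁺ʳ; ∈-++⁻; ∈-insert; ∈-∃++; ∈-applyDownFrom⁺; ∈-applyDownFrom⁻)
open import Data.List.Relation.Unary.Any using (here; there)
import Data.List.Relation.Unary.All as All
open import Data.List.Relation.Unary.AllPairs using (_∷_)
open import Data.List.Relation.Unary.Unique.Propositional using (Unique)
open import Data.List.Relation.Unary.Unique.Propositional.Properties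
  using (applyDownFrom⁺₁; Unique[x∷xs]⇒x∉xs)
open import Data.List.Relation.Binary.Permutation.Propositional.Properties using (↭-reverse)
open import Data.Product using (∃; _,_; proj₁; proj₂) renaming (_×_ to _∧_)
open import Data.Sum using (_⊎_; inj₁; inj₂)
open import Data.Empty using (⊥-elim)
open import Data.Maybe using (nothing)
open import Function using (_∘_)
open import Relation.Nullary using (¬_; yes; no; map′)
open import Relation.Binary.Definitions using (Decidable; tri<; tri≈; tri>)
open import Relation.Binary.PropositionalEquality as ≡ using (_≡_; _≢_)
open import Algebra.Bundles using (CommutativeRing; CommutativeMonoid)
open import Tactic.RingSolver.Core.AlmostCommutativeRing using (fromCommutativeRing)

product-applyDownFrom-suc : ∀ n → product (applyDownFrom suc n) ≡ n !
product-applyDownFrom-suc zero    = ≡.refl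
product-applyDownFrom-suc (suc n) = ≡.cong (suc n ℕ.*_) (product-applyDownFrom-suc n)

product-applyUpTo-suc : ∀ n → product (applyUpTo suc n) ≡ n !
product-applyUpTo-suc n = ≡.trans (≡.sym (product-↭ (↭-reverse (applyUpTo suc n))))
  (≡.trans (≡.cong product (reverse-applyUpTo suc n)) (product-applyDownFrom-suc n))

∈-applyDownFrom-suc⁻ : ∀ {n j} → j ∈ applyDownFrom suc n → 0 < j ∧ j ≤ n
∈-applyDownFrom-suc⁻ j∈ with ∈-applyDownFrom⁻ suc j∈
... | i , i<n , ≡.refl = s≤s z≤n , i<n

∈-applyDownFrom-suc⁺ : ∀ {n j} → 0 < j → j ≤ n → j ∈ applyDownFrom suc n
∈-applyDownFrom-suc⁺ {j = suc i} _ i<n = ∈-applyDownFrom⁺ suc i<n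

module ListRemoval {a} {A : Set a} {y : A} where

  ∈-insert-mid : ∀ ys₁ {ys₂ z} → z ∈ ys₁ ++ ys₂ → z ∈ ys₁ ++ y ∷ ys₂
  ∈-insert-mid ys₁ z∈ with ∈-++⁻ ys₁ z∈
  ... | inj₁ z∈ys₁ = ∈-++⁺ˡ z∈ys₁
  ... | inj₂ z∈ys₂ = ∈-++⁺ʳ ys₁ (there z∈ys₂)

  ∈-drop-mid : ∀ ys₁ {ys₂ z} → z ∈ ys₁ ++ y ∷ ys₂ → z ≡ y ⊎ z ∈ ys₁ ++ ys₂
  ∈-drop-mid ys₁ z∈ with ∈-++⁻ ys₁ z∈
  ... | inj₁ z∈ys₁         = inj₂ (∈-++⁺ˡ z∈ys₁)
  ... | inj₂ (here z≡y)    = inj₁ z≡y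
  ... | inj₂ (there z∈ys₂) = inj₂ (∈-++⁺ʳ ys₁ z∈ys₂)

  unique-drop-mid : ∀ ys₁ {ys₂} → Unique (ys₁ ++ y ∷ ys₂) →
                    y ∉ ys₁ ++ ys₂ ∧ Unique (ys₁ ++ ys₂)
  unique-drop-mid []        unique@(_ ∷ rest) = Unique[x∷xs]⇒x∉xs unique , rest
  unique-drop-mid (z ∷ ys₁) (z∉ ∷ unique) with unique-drop-mid ys₁ unique
  ... | y∉ , unique′ =
    y∉z∷ , All.tabulate (λ w∈ → All.lookup z∉ (∈-insert-mid ys₁ w∈)) ∷ unique′
    where
    y∉z∷ : y ∉ z ∷ ys₁ ++ _
    y∉z∷ (here y≡z) = All.lookup z∉ (∈-insert ys₁) (≡.sym y≡z)
    y∉z∷ (there y∈) = y∉ y∈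

  length-drop-mid : ∀ ys₁ {ys₂} → length (ys₁ ++ y ∷ ys₂) ≡ suc (length (ys₁ ++ ys₂))
  length-drop-mid []        = ≡.refl
  length-drop-mid (_ ∷ ys₁) = ≡.cong suc (length-drop-mid ys₁)

module ProductPairing {c ℓ a} (M : CommutativeMonoid c ℓ) {A : Set a}
                      (f : A → CommutativeMonoid.Carrier M) where
  open CommutativeMonoid M
  open ListRemoval
  open import Relation.Binary.Reasoning.Setoid setoid

  ∏ : List A → Carrier
  ∏ xs = foldr _∙_ ε (map f xs)

  InjectiveOn : List A → Set _
  InjectiveOn xs = ∀ {x y} → x ∈ xs → y ∈ xs → f x ≈ f y → x ≡ y

  PairedOn : List A → Set _
  PairedOn xs = ∀ {x} → x ∈ xs → f x ≈ ε ⊎ ∃ λ y → y ∈ xs ∧ y ≢ x ∧ f x ∙ f y ≈ ε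

  inverse-unique : ∀ {x y z} → x ∙ z ≈ ε → y ∙ z ≈ ε → x ≈ y
  inverse-unique {x} {y} {z} xz≈ε yz≈ε = begin
    x              ≈⟨ identityʳ x ⟨
    x ∙ ε          ≈⟨ ∙-congˡ (trans (sym yz≈ε) (comm y z)) ⟩
    x ∙ (z ∙ y)    ≈⟨ assoc x z y ⟨
    (x ∙ z) ∙ y    ≈⟨ ∙-congʳ xz≈ε ⟩
    ε ∙ y          ≈⟨ identityˡ y ⟩
    y              ∎

  ∏-drop-mid : ∀ ys₁ {y ys₂} → ∏ (ys₁ ++ y ∷ ys₂) ≈ f y ∙ ∏ (ys₁ ++ ys₂)
  ∏-drop-mid []                  = refl
  ∏-drop-mid (z ∷ ys₁) {y} {ys₂} = begin
    f z ∙ ∏ (ys₁ ++ y ∷ ys₂)        ≈⟨ ∙-congˡ (∏-drop-mid ys₁) ⟩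
    f z ∙ (f y ∙ ∏ (ys₁ ++ ys₂))    ≈⟨ assoc (f z) (f y) _ ⟨
    (f z ∙ f y) ∙ ∏ (ys₁ ++ ys₂)    ≈⟨ ∙-congʳ (comm (f z) (f y)) ⟩
    (f y ∙ f z) ∙ ∏ (ys₁ ++ ys₂)    ≈⟨ assoc (f y) (f z) _ ⟩
    f y ∙ ∏ (z ∷ ys₁ ++ ys₂)        ∎

  paired-drop-unit : ∀ {x ys} → f x ≈ ε → PairedOn (x ∷ ys) → PairedOn ys
  paired-drop-unit fx≈ε paired z∈ with paired (there z∈)
  ... | inj₁ fz≈ε = inj₁ fz≈ε
  ... | inj₂ (_ , here ≡.refl , _ , fzfx≈ε) =
    inj₁ (trans (sym (identityʳ _)) (trans (∙-congˡ (sym fx≈ε)) fzfx≈ε))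
  ... | inj₂ (z′ , there z′∈ , z′≢z , fzfz′≈ε) = inj₂ (z′ , z′∈ , z′≢z , fzfz′≈ε)

  paired-drop-pair : ∀ {x y} ys₁ {ys₂} → let xs = x ∷ ys₁ ++ y ∷ ys₂ in
                     Unique xs → InjectiveOn xs → f x ∙ f y ≈ ε → PairedOn xs → PairedOn (ys₁ ++ ys₂)
  paired-drop-pair {x} {y} ys₁ (x∉ys ∷ unique) inj fxfy≈ε paired {z} z∈
    with paired (there (∈-insert-mid ys₁ z∈))
  ... | inj₁ fz≈ε = inj₁ fz≈ε
  ... | inj₂ (_ , here ≡.refl , _ , fzfx≈ε) =
    ⊥-elim (proj₁ (unique-drop-mid ys₁ unique) (≡.subst (_∈ _) z≡y z∈))
    where
    z≡y : z ≡ y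
    z≡y = inj (there (∈-insert-mid ys₁ z∈)) (there (∈-insert ys₁))
              (inverse-unique fzfx≈ε (trans (comm (f y) (f x)) fxfy≈ε))
  ... | inj₂ (z′ , there z′∈ys , z′≢z , fzfz′≈ε) with ∈-drop-mid ys₁ z′∈ys
  ...   | inj₂ z′∈rest = inj₂ (z′ , z′∈rest , z′≢z , fzfz′≈ε)
  ...   | inj₁ ≡.refl  = ⊥-elim (All.lookup x∉ys (∈-insert-mid ys₁ z∈) (≡.sym z≡x))
    where
    z≡x : z ≡ x
    z≡x = inj (there (∈-insert-mid ys₁ z∈)) (here ≡.refl) (inverse-unique fzfz′≈ε fxfy≈ε)

  ∏-paired : ∀ xs → Unique xs → InjectiveOn xs → PairedOn xs → ∏ xs ≈ ε
  ∏-paired xs = go (suc (length xs)) xs ℕ.≤-refl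
    where
    go : ∀ n xs → length xs < n → Unique xs → InjectiveOn xs → PairedOn xs → ∏ xs ≈ ε
    go n       []       _            _                    _   _      = refl
    go (suc n) (x ∷ ys) (s≤s |ys|<n) unique@(_ ∷ unique′) inj paired with paired (here ≡.refl)
    ... | inj₁ fx≈ε = begin
      f x ∙ ∏ ys    ≈⟨ ∙-congʳ fx≈ε ⟩
      ε ∙ ∏ ys      ≈⟨ identityˡ _ ⟩
      ∏ ys          ≈⟨ go n ys |ys|<n unique′ (λ y∈ z∈ → inj (there y∈) (there z∈))
                          (paired-drop-unit fx≈ε paired) ⟩
      ε             ∎
    ... | inj₂ (y , here y≡x , y≢x , _) = ⊥-elim (y≢x y≡x)
    ... | inj₂ (y , there y∈ys , _ , fxfy≈ε) with ∈-∃++ y∈ys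
    ... | ys₁ , ys₂ , ≡.refl = begin
      f x ∙ ∏ (ys₁ ++ y ∷ ys₂)       ≈⟨ ∙-congˡ (∏-drop-mid ys₁) ⟩
      f x ∙ (f y ∙ ∏ (ys₁ ++ ys₂))   ≈⟨ assoc (f x) (f y) _ ⟨
      (f x ∙ f y) ∙ ∏ (ys₁ ++ ys₂)   ≈⟨ ∙-congʳ fxfy≈ε ⟩
      ε ∙ ∏ (ys₁ ++ ys₂)             ≈⟨ identityˡ _ ⟩
      ∏ (ys₁ ++ ys₂)                 ≈⟨ go n (ys₁ ++ ys₂) |rest|<n (proj₂ (unique-drop-mid ys₁ unique′))
                                          (λ z∈ w∈ → inj (inward z∈) (inward w∈))
                                          (paired-drop-pair ys₁ unique inj fxfy≈ε paired) ⟩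
      ε                              ∎
      where
      |rest|<n : length (ys₁ ++ ys₂) < n
      |rest|<n = ℕ.<-trans (ℕ.≤-reflexive (≡.sym (length-drop-mid ys₁))) |ys|<n
      inward : ∀ {z} → z ∈ ys₁ ++ ys₂ → z ∈ x ∷ ys₁ ++ y ∷ ys₂
      inward z∈ = there (∈-insert-mid ys₁ z∈)

module NaturalMultiples {c ℓ} (K : CommutativeRing c ℓ) where
  open CommutativeRing K hiding (zero)
  open import Algebra.Properties.Semiring.Mult semiring public
    using (_×_; ×-congʳ; ×-congˡ; ×-homo-1; ×-homo-+; ×-assocˡ; ×-assoc-*; ×1-homo-*)
  open import Algebra.Properties.CommutativeMonoid.Mult +-commutativeMonoid using (×-distrib-+)
  open import Algebra.Properties.Ring ring using (-‿distribʳ-*)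

  ·≡× : ∀ n a → _·_ K n a ≡ n × a
  ·≡× zero    a = ≡.refl
  ·≡× (suc n) a = ≡.cong (a +_) (·≡× n a)

  n×x≈[n×1]*x : ∀ n x → n × x ≈ (n × 1#) * x
  n×x≈[n×1]*x n x = sym (trans (×-assoc-* n 1# x) (×-congʳ n (*-identityˡ x)))

  n×[-x]≈-[n×x] : ∀ n x → n × (- x) ≈ - (n × x)
  n×[-x]≈-[n×x] n x = trans (n×x≈[n×1]*x n (- x))
    (trans (sym (-‿distribʳ-* _ x)) (-‿cong (sym (n×x≈[n×1]*x n x))))

  n×[x-y]≈n×x-n×y : ∀ n x y → n × (x - y) ≈ n × x - n × y
  n×[x-y]≈n×x-n×y n x y = trans (×-distrib-+ x (- y) n) (+-congˡ (n×[-x]≈-[n×x] n y))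

  ×1-homo-product : ∀ ns → product ns × 1# ≈ foldr _*_ 1# (map (_× 1#) ns)
  ×1-homo-product []       = ×-homo-1 1#
  ×1-homo-product (n ∷ ns) = trans (×1-homo-* n (product ns)) (*-congˡ (×1-homo-product ns))

module CardinalityFacts {c ℓ} (K : CommutativeRing c ℓ) {N : ℕ} (card : HasCardinality K N) where
  open CommutativeRing K
  open HasCardinality card
  open NaturalMultiples K using (_×_)
  open import Algebra.Properties.CommutativeMonoid.Sum +-commutativeMonoid
    using (sum; sum-permute; sum-cong-≋; ∑-distrib-+; sum-replicate)
  open import Algebra.Properties.Ring ring using (+-identityʳ-unique; //-rightDividesˡ; //-rightDividesʳ)
  open import Relation.Binary.Reasoning.Setoid setoid

  card⇒decidable : Decidable _≈_
  card⇒decidable x y with enum-surj x | enum-surj y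
  ... | i , i↦x | j , j↦y = map′
    (λ i≡j → trans (sym i↦x) (trans (reflexive (≡.cong enum i≡j)) j↦y))
    (λ x≈y → enum-inj i j (trans i↦x (trans x≈y (sym j↦y))))
    (i Fin.≟ j)

  card-annihilates : ∀ x → N × x ≈ 0#
  card-annihilates x = +-identityʳ-unique (sum enum) (N × x) (sym (begin
    sum enum                        ≈⟨ sum-permute enum translation ⟩
    sum (enum ∘ shift)              ≈⟨ sum-cong-≋ shift-spec ⟩
    sum (λ i → enum i + x)          ≈⟨ ∑-distrib-+ enum (λ _ → x) ⟩
    sum enum + sum {N} (λ _ → x)    ≈⟨ +-congˡ (sum-replicate N) ⟩
    sum enum + N × x                ∎))
    where
    shift unshift : Fin N → Fin N
    shift i = proj₁ (enum-surj (enum i + x))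
    unshift i = proj₁ (enum-surj (enum i - x))
    shift-spec : ∀ i → enum (shift i) ≈ enum i + x
    shift-spec i = proj₂ (enum-surj (enum i + x))
    unshift-spec : ∀ i → enum (unshift i) ≈ enum i - x
    unshift-spec i = proj₂ (enum-surj (enum i - x))
    translation : Permutation N N
    translation = permutation shift unshift
      (λ i → enum-inj _ _ (trans (shift-spec (unshift i))
                                 (trans (+-congʳ (unshift-spec i)) (//-rightDividesˡ x _))))
      (λ i → enum-inj _ _ (trans (unshift-spec (shift i))
                                 (trans (+-congʳ (shift-spec i)) (//-rightDividesʳ x _))))

module FieldFacts {c ℓ} (K : CommutativeRing c ℓ) (isField : IsField K)
                  (_≟_ : Decidable (CommutativeRing._≈_ K)) where
  open CommutativeRing K hiding (zero)
  open IsField isField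
  open NaturalMultiples K using (_×_; ×1-homo-*)
  open import Algebra.Properties.Ring ring using (+-inverseˡ-unique; x∙y⁻¹≈ε⇒x≈y; [y-z]x≈yx-zx)
  open import Relation.Binary.Reasoning.Setoid setoid

  x*y≈0⇒x≈0∨y≈0 : ∀ x y → x * y ≈ 0# → x ≈ 0# ⊎ y ≈ 0#
  x*y≈0⇒x≈0∨y≈0 x y xy≈0 with x ≟ 0#
  ... | yes x≈0 = inj₁ x≈0
  ... | no x≉0 with inverse x x≉0
  ... | x⁻¹ , xx⁻¹≈1 = inj₂ (begin
    y                ≈⟨ *-identityˡ y ⟨
    1# * y           ≈⟨ *-congʳ (trans (sym xx⁻¹≈1) (*-comm x x⁻¹)) ⟩
    (x⁻¹ * x) * y    ≈⟨ *-assoc x⁻¹ x y ⟩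
    x⁻¹ * (x * y)    ≈⟨ *-congˡ xy≈0 ⟩
    x⁻¹ * 0#         ≈⟨ zeroʳ x⁻¹ ⟩
    0#               ∎)

  x*x≈1⇒x≈±1 : ∀ x → x * x ≈ 1# → x ≈ 1# ⊎ x ≈ - 1#
  x*x≈1⇒x≈±1 x xx≈1 with x*y≈0⇒x≈0∨y≈0 (x - 1#) (x + 1#) factored
    where
    factored : (x - 1#) * (x + 1#) ≈ 0#
    factored = begin
      (x - 1#) * (x + 1#)            ≈⟨ [y-z]x≈yx-zx (x + 1#) x 1# ⟩
      x * (x + 1#) - 1# * (x + 1#)   ≈⟨ +-cong (distribˡ x x 1#) (-‿cong (*-identityˡ _)) ⟩
      (x * x + x * 1#) - (x + 1#)    ≈⟨ +-congʳ (+-cong xx≈1 (*-identityʳ x)) ⟩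
      (1# + x) - (x + 1#)            ≈⟨ +-congʳ (+-comm 1# x) ⟩
      (x + 1#) - (x + 1#)            ≈⟨ -‿inverseʳ (x + 1#) ⟩
      0#                             ∎
  ... | inj₁ x-1≈0 = inj₁ (x∙y⁻¹≈ε⇒x≈y x 1# x-1≈0)
  ... | inj₂ x+1≈0 = inj₂ (+-inverseˡ-unique x 1# x+1≈0)

  [m^n]×1≈0⇒m×1≈0 : ∀ m n → (m ^ n) × 1# ≈ 0# → m × 1# ≈ 0#
  [m^n]×1≈0⇒m×1≈0 m zero    1+0≈0 = ⊥-elim (1≉0 (trans (sym (+-identityʳ 1#)) 1+0≈0))
  [m^n]×1≈0⇒m×1≈0 m (suc n) mmⁿ≈0
    with x*y≈0⇒x≈0∨y≈0 (m × 1#) ((m ^ n) × 1#) (trans (sym (×1-homo-* m (m ^ n))) mmⁿ≈0)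
  ... | inj₁ m≈0  = m≈0
  ... | inj₂ mⁿ≈0 = [m^n]×1≈0⇒m×1≈0 m n mⁿ≈0

module PrimeCharacteristic {c ℓ} (K : CommutativeRing c ℓ) where
  open CommutativeRing K hiding (zero)
  open NaturalMultiples K
  open import Algebra.Properties.Ring ring
    using (+-inverseʳ-unique; +-identityʳ-unique; -‿distribʳ-*; -‿involutive; -1*x≈-x)
  open import Relation.Binary.Reasoning.Setoid setoid

  module _ {k : ℕ} (p-prime : Prime (2 ℕ.+ k)) (char : (2 ℕ.+ k) × 1# ≈ 0#) where
    private
      p : ℕ
      p = 2 ℕ.+ k

    p×x≈0 : ∀ x → p × x ≈ 0#
    p×x≈0 x = trans (n×x≈[n×1]*x p x) (trans (*-congʳ char) (zeroˡ x))

    [p-1]×1≈-1 : (p ∸ 1) × 1# ≈ - 1#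
    [p-1]×1≈-1 = +-inverseʳ-unique 1# _ char

    [m*p]×1≈0 : ∀ m → (m ℕ.* p) × 1# ≈ 0#
    [m*p]×1≈0 m = trans (×1-homo-* m p) (trans (*-congˡ char) (zeroʳ _))

    ×1-mod : ∀ m → m × 1# ≈ (m % p) × 1#
    ×1-mod m = begin
      m × 1#                                ≈⟨ ×-congˡ (m≡m%n+[m/n]*n m p) ⟩
      (m % p ℕ.+ (m / p) ℕ.* p) × 1#        ≈⟨ ×-homo-+ 1# (m % p) _ ⟩
      (m % p) × 1# + ((m / p) ℕ.* p) × 1#   ≈⟨ +-congˡ ([m*p]×1≈0 (m / p)) ⟩
      (m % p) × 1# + 0#                     ≈⟨ +-identityʳ _ ⟩
      (m % p) × 1#                          ∎

    ×1-has-inverse : ∀ {j} → 0 < j → j < p → ∃ λ m → (j × 1#) * (m × 1#) ≈ 1#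
    ×1-has-inverse {j} 0<j j<p with coprime-Bézout (prime⇒coprime p-prime {{ℕ.>-nonZero 0<j}} j<p)
    ... | Bézout.+- x y 1+yj≡xp = (p ∸ 1) ℕ.* y , (begin
      (j × 1#) * (((p ∸ 1) ℕ.* y) × 1#)   ≈⟨ *-congˡ (trans (×1-homo-* (p ∸ 1) y)
                                                         (*-congʳ [p-1]×1≈-1)) ⟩
      (j × 1#) * (- 1# * (y × 1#))       ≈⟨ *-congˡ (-1*x≈-x _) ⟩
      (j × 1#) * - (y × 1#)              ≈⟨ -‿distribʳ-* _ _ ⟨
      - ((j × 1#) * (y × 1#))            ≈⟨ -‿cong (+-inverseʳ-unique 1# _ 1+jy≈0) ⟩
      - - 1#                             ≈⟨ -‿involutive 1# ⟩
      1#                                 ∎)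
      where
      1+jy≈0 : 1# + (j × 1#) * (y × 1#) ≈ 0#
      1+jy≈0 = begin
        1# + (j × 1#) * (y × 1#)   ≈⟨ +-cong (sym (×-homo-1 1#))
                                              (trans (*-comm _ _) (sym (×1-homo-* y j))) ⟩
        1 × 1# + (y ℕ.* j) × 1#    ≈⟨ ×-homo-+ 1# 1 (y ℕ.* j) ⟨
        (1 ℕ.+ y ℕ.* j) × 1#       ≈⟨ ×-congˡ 1+yj≡xp ⟩
        (x ℕ.* p) × 1#             ≈⟨ [m*p]×1≈0 x ⟩
        0#                         ∎
    ... | Bézout.-+ x y 1+xp≡yj = y , (begin
      (j × 1#) * (y × 1#)        ≈⟨ *-comm _ _ ⟩
      (y × 1#) * (j × 1#)        ≈⟨ ×1-homo-* y j ⟨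
      (y ℕ.* j) × 1#             ≈⟨ ×-congˡ 1+xp≡yj ⟨
      (1 ℕ.+ x ℕ.* p) × 1#       ≈⟨ ×-homo-+ 1# 1 (x ℕ.* p) ⟩
      1 × 1# + (x ℕ.* p) × 1#    ≈⟨ +-cong (×-homo-1 1#) ([m*p]×1≈0 x) ⟩
      1# + 0#                    ≈⟨ +-identityʳ 1# ⟩
      1#                         ∎)

    ×1-invertible : ∀ {j} → 0 < j → j < p → ∃ λ l → l < p ∧ (j × 1#) * (l × 1#) ≈ 1#
    ×1-invertible 0<j j<p with ×1-has-inverse 0<j j<p
    ... | m , jm≈1 = m % p , m%n<n m p , trans (*-congˡ (sym (×1-mod m))) jm≈1

    ×-cancel : ∀ {j} → 0 < j → j < p → ∀ {x} → j × x ≈ 0# → x ≈ 0#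
    ×-cancel {j} 0<j j<p {x} jx≈0 with ×1-has-inverse 0<j j<p
    ... | m , jm≈1 = begin
      x                              ≈⟨ *-identityˡ x ⟨
      1# * x                         ≈⟨ *-congʳ (trans (sym jm≈1) (*-comm _ _)) ⟩
      ((m × 1#) * (j × 1#)) * x      ≈⟨ *-assoc _ _ x ⟩
      (m × 1#) * ((j × 1#) * x)      ≈⟨ *-congˡ (trans (sym (n×x≈[n×1]*x j x)) jx≈0) ⟩
      (m × 1#) * 0#                  ≈⟨ zeroʳ _ ⟩
      0#                             ∎

    ×1≈×1⇒[n∸m]×1≈0 : ∀ {m n} → m ≤ n → m × 1# ≈ n × 1# → (n ∸ m) × 1# ≈ 0#
    ×1≈×1⇒[n∸m]×1≈0 {m} {n} m≤n m≈n = +-identityʳ-unique (m × 1#) _ (begin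
      m × 1# + (n ∸ m) × 1#    ≈⟨ ×-homo-+ 1# m (n ∸ m) ⟨
      (m ℕ.+ (n ∸ m)) × 1#     ≈⟨ ×-congˡ (ℕ.m+[n∸m]≡n m≤n) ⟩
      n × 1#                   ≈⟨ m≈n ⟨
      m × 1#                   ∎)

    ×1-injective : ¬ (1# ≈ 0#) → ∀ {i j} → i < p → j < p → i × 1# ≈ j × 1# → i ≡ j
    ×1-injective 1≉0 {i} {j} i<p j<p i≈j with ℕ.<-cmp i j
    ... | tri< i<j _ _ = ⊥-elim (1≉0 (×-cancel (ℕ.m<n⇒0<n∸m i<j) (ℕ.≤-<-trans (ℕ.m∸n≤m j i) j<p)
                                       (×1≈×1⇒[n∸m]×1≈0 (ℕ.<⇒≤ i<j) i≈j)))
    ... | tri≈ _ i≡j _ = i≡j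
    ... | tri> _ _ j<i = ⊥-elim (1≉0 (×-cancel (ℕ.m<n⇒0<n∸m j<i) (ℕ.≤-<-trans (ℕ.m∸n≤m i j) i<p)
                                       (×1≈×1⇒[n∸m]×1≈0 (ℕ.<⇒≤ j<i) (sym i≈j))))

    module _ (isField : IsField K) (_≟_ : Decidable _≈_) where
      open FieldFacts K isField _≟_ using (x*x≈1⇒x≈±1)
      open IsField isField using (1≉0)
      open ProductPairing *-commutativeMonoid (_× 1#) using (∏; ∏-paired; InjectiveOn; PairedOn; inverse-unique)

      ×1-self-inverse : ∀ {j} → j < p → (j × 1#) * (j × 1#) ≈ 1# → j ≡ 1 ⊎ j ≡ p ∸ 1
      ×1-self-inverse j<p jj≈1 with x*x≈1⇒x≈±1 _ jj≈1
      ... | inj₁ j≈1  = inj₁ (×1-injective 1≉0 j<p (s≤s (s≤s z≤n)) (trans j≈1 (sym (×-homo-1 1#))))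
      ... | inj₂ j≈-1 = inj₂ (×1-injective 1≉0 j<p ℕ.≤-refl (trans j≈-1 (sym [p-1]×1≈-1)))

      [p-1]×1-self-inverse : ((p ∸ 1) × 1#) * ((p ∸ 1) × 1#) ≈ 1#
      [p-1]×1-self-inverse = begin
        ((p ∸ 1) × 1#) * ((p ∸ 1) × 1#)  ≈⟨ *-cong [p-1]×1≈-1 [p-1]×1≈-1 ⟩
        - 1# * - 1#                      ≈⟨ -1*x≈-x (- 1#) ⟩
        - - 1#                           ≈⟨ -‿involutive 1# ⟩
        1#                               ∎

      [p-2]!×1≈1 : ((p ∸ 2) !) × 1# ≈ 1#
      [p-2]!×1≈1 = begin
        ((p ∸ 2) !) × 1#      ≈⟨ ×-congˡ (≡.sym (product-applyDownFrom-suc (p ∸ 2))) ⟩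
        product units × 1#    ≈⟨ ×1-homo-product units ⟩
        ∏ units               ≈⟨ ∏-paired units unique injective paired ⟩
        1#                    ∎
        where
        units : List ℕ
        units = applyDownFrom suc (p ∸ 2)
        unit<p : ∀ {j} → j ∈ units → j < p
        unit<p j∈ = s≤s (ℕ.m≤n⇒m≤1+n (proj₂ (∈-applyDownFrom-suc⁻ j∈)))
        unique : Unique units
        unique = applyDownFrom⁺₁ suc (p ∸ 2)
                   (λ j<i _ i≡j → ℕ.<⇒≢ j<i (≡.sym (ℕ.suc-injective i≡j)))
        injective : InjectiveOn units
        injective j∈ l∈ = ×1-injective 1≉0 (unit<p j∈) (unit<p l∈)
        paired : PairedOn units
        paired {j} j∈ with ×1-invertible (proj₁ (∈-applyDownFrom-suc⁻ j∈)) (unit<p j∈)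
        ... | l , l<p , jl≈1 with l ℕ.≟ j
        ... | no l≢j = inj₂ (l , ∈-applyDownFrom-suc⁺ (ℕ.n≢0⇒n>0 l≢0) l≤p-2 , l≢j , jl≈1)
          where
          l≢0 : l ≢ 0
          l≢0 ≡.refl = 1≉0 (trans (sym jl≈1) (zeroʳ _))
          l≢p-1 : l ≢ p ∸ 1
          l≢p-1 ≡.refl =
            l≢j (×1-injective 1≉0 l<p (unit<p j∈) (inverse-unique [p-1]×1-self-inverse jl≈1))
          l≤p-2 : l ≤ p ∸ 2
          l≤p-2 = ℕ.≤-pred (ℕ.≤∧≢⇒< (ℕ.≤-pred l<p) l≢p-1)
        ... | yes ≡.refl with ×1-self-inverse l<p jl≈1
        ...   | inj₁ ≡.refl = inj₁ (×-homo-1 1#)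
        ...   | inj₂ ≡.refl = ⊥-elim (ℕ.<-irrefl ≡.refl (proj₂ (∈-applyDownFrom-suc⁻ j∈)))

      wilson : ((p ∸ 1) !) × 1# ≈ - 1#
      wilson = begin
        ((p ∸ 1) !) × 1#                      ≈⟨ ×1-homo-* (p ∸ 1) ((p ∸ 2) !) ⟩
        ((p ∸ 1) × 1#) * (((p ∸ 2) !) × 1#)   ≈⟨ *-cong [p-1]×1≈-1 [p-2]!×1≈1 ⟩
        - 1# * 1#                             ≈⟨ *-identityʳ (- 1#) ⟩
        - 1#                                  ∎

module BinomialCoefficients {c ℓ} (K : CommutativeRing c ℓ) where
  open CommutativeRing K hiding (zero)
  open NaturalMultiples K
  open import Algebra.Properties.Ring ring using (-0#≈0#)
  open import Relation.Binary.Reasoning.Setoid setoid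

  -- coeff k i is the coefficient of X ^ i in (X - 1) ^ k.
  coeff : ℕ → ℕ → Carrier
  coeff zero    zero    = 1#
  coeff zero    (suc i) = 0#
  coeff (suc k) zero    = - coeff k zero
  coeff (suc k) (suc i) = coeff k i - coeff k (suc i)

  coeff-absorption : ∀ k i → suc i × coeff (suc k) (suc i) ≈ suc k × coeff k i
  coeff-absorption zero    zero    = ×-congʳ 1 (trans (+-congˡ -0#≈0#) (+-identityʳ 1#))
  coeff-absorption zero    (suc i) = begin
    suc (suc i) × (0# - 0#)   ≈⟨ ×-congʳ (suc (suc i)) (-‿inverseʳ 0#) ⟩
    suc (suc i) × 0#          ≈⟨ n×x≈[n×1]*x (suc (suc i)) 0# ⟩
    _ * 0#                    ≈⟨ zeroʳ _ ⟩
    0#                        ≈⟨ +-identityʳ 0# ⟨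
    1 × 0#                    ∎
  coeff-absorption (suc k) zero    = begin
    1 × (A - coeff (suc k) 1)   ≈⟨ ×-homo-1 _ ⟩
    A - coeff (suc k) 1         ≈⟨ +-congˡ (-‿cong (trans (sym (×-homo-1 _)) (coeff-absorption k zero))) ⟩
    A - suc k × coeff k 0       ≈⟨ +-congˡ (n×[-x]≈-[n×x] (suc k) (coeff k 0)) ⟨
    A + suc k × A               ∎
    where
    A = coeff (suc k) 0
  coeff-absorption (suc k) (suc i) = begin
    suc (suc i) × (X - Y)                                ≈⟨ n×[x-y]≈n×x-n×y (suc (suc i)) X Y ⟩
    (X + suc i × X) - suc (suc i) × Y                    ≈⟨ +-cong (+-congˡ (coeff-absorption k i))
                                                                   (-‿cong (coeff-absorption k (suc i))) ⟩
    (X + suc k × coeff k i) - suc k × coeff k (suc i)    ≈⟨ +-assoc X _ _ ⟩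
    X + (suc k × coeff k i - suc k × coeff k (suc i))    ≈⟨ +-congˡ (n×[x-y]≈n×x-n×y (suc k) _ _) ⟨
    X + suc k × X                                        ∎
    where
    X = coeff (suc k) (suc i)
    Y = coeff (suc k) (suc (suc i))

module Differences {c ℓ} (K : CommutativeRing c ℓ) where
  open CommutativeRing K hiding (zero)
  open import Algebra.Definitions _≈_ using (Congruent₁)
  open import Algebra.Properties.CommutativeMonoid.Sum +-commutativeMonoid using (sum)
  open import Algebra.Properties.Ring ring using (-0#≈0#; //-cong₂)
  open import Tactic.RingSolver.NonReflective (fromCommutativeRing K (λ _ → nothing))
    using (solve; _⊜_; _⊕_; ⊝_)
  open import Relation.Binary.Reasoning.Setoid setoid

  [a-b]+[b-c]≈a-c : ∀ a b c → (a - b) + (b - c) ≈ a - c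
  [a-b]+[b-c]≈a-c a b c = begin
    (a - b) + (b - c)     ≈⟨ +-assoc a (- b) _ ⟩
    a + (- b + (b - c))   ≈⟨ +-congˡ (+-assoc (- b) b (- c)) ⟨
    a + ((- b + b) - c)   ≈⟨ +-congˡ (+-congʳ (-‿inverseˡ b)) ⟩
    a + (0# - c)          ≈⟨ +-congˡ (+-identityˡ (- c)) ⟩
    a - c                 ∎

  ∑[f-g]≈∑f-∑g : ∀ {n} (f g : Fin n → Carrier) → sum (λ i → f i - g i) ≈ sum f - sum g
  ∑[f-g]≈∑f-∑g {zero}  f g = sym (trans (+-congˡ -0#≈0#) (+-identityʳ 0#))
  ∑[f-g]≈∑f-∑g {suc n} f g = begin
    (f Fin.zero - g Fin.zero) + sum (λ i → f (Fin.suc i) - g (Fin.suc i))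
      ≈⟨ +-congˡ (∑[f-g]≈∑f-∑g (f ∘ Fin.suc) (g ∘ Fin.suc)) ⟩
    (f Fin.zero - g Fin.zero) + (sum (f ∘ Fin.suc) - sum (g ∘ Fin.suc))
      ≈⟨ solve 4 (λ a b c d → ((a ⊕ ⊝ b) ⊕ (c ⊕ ⊝ d)) ⊜ ((a ⊕ c) ⊕ ⊝ (b ⊕ d))) refl _ _ _ _ ⟩
    sum f - sum g ∎

  Δ-cong : ∀ as {F} → Congruent₁ F → Congruent₁ (Δ K as F)
  Δ-cong []       F-cong x≈y = F-cong x≈y
  Δ-cong (a ∷ as) F-cong x≈y = //-cong₂ (Δ-cong as F-cong (+-congʳ x≈y)) (Δ-cong as F-cong x≈y)

  Δ-comm : ∀ a as {F} → Congruent₁ F → ∀ x → Δ K (a ∷ as) F x ≈ Δ K as (Δ K (a ∷ []) F) x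
  Δ-comm a []       F-cong x = refl
  Δ-comm a (b ∷ as) {F} F-cong x = begin
    (G ((x + a) + b) - G (x + a)) - (G (x + b) - G x)
      ≈⟨ //-cong₂ (//-cong₂ (Δ-cong as F-cong shift-swap) refl) refl ⟩
    (G ((x + b) + a) - G (x + a)) - (G (x + b) - G x)
      ≈⟨ solve 4 (λ A B C D → ((A ⊕ ⊝ B) ⊕ ⊝ (C ⊕ ⊝ D)) ⊜ ((A ⊕ ⊝ C) ⊕ ⊝ (B ⊕ ⊝ D))) refl _ _ _ _ ⟩
    (G ((x + b) + a) - G (x + b)) - (G (x + a) - G x)
      ≈⟨ //-cong₂ (Δ-comm a as F-cong (x + b)) (Δ-comm a as F-cong x) ⟩
    Δ K (b ∷ as) (Δ K (a ∷ []) F) x ∎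
    where
    G = Δ K as F
    shift-swap : (x + a) + b ≈ (x + b) + a
    shift-swap = trans (+-assoc x a b) (trans (+-congˡ (+-comm a b)) (sym (+-assoc x b a)))

  Δ-const-invariant : ∀ as c x y → Δ K as (λ _ → c) x ≡ Δ K as (λ _ → c) y
  Δ-const-invariant []       c x y = ≡.refl
  Δ-const-invariant (a ∷ as) c x y =
    ≡.cong₂ _-_ (Δ-const-invariant as c (x + a) (y + a)) (Δ-const-invariant as c x y)

  Δ-const : ∀ a as c x → Δ K (a ∷ as) (λ _ → c) x ≈ 0#
  Δ-const a as c x = trans (+-congʳ (reflexive (Δ-const-invariant as c (x + a) x))) (-‿inverseʳ _)

module IteratedDifferences {c ℓ} (K : CommutativeRing c ℓ) (α : CommutativeRing.Carrier K) where
  open CommutativeRing K hiding (zero)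
  open NaturalMultiples K
  open BinomialCoefficients K
  open Differences K
  open import Algebra.Definitions _≈_ using (Congruent₁)
  open import Algebra.Properties.CommutativeMonoid.Sum +-commutativeMonoid
    using (sum; sum-cong-≋; sum-replicate-zero)
  open import Algebra.Properties.Ring ring
    using (//-cong₂; -‿distribˡ-*; [y-z]x≈yx-zx; x∙y⁻¹≈ε⇒x≈y; -1*x≈-x)
  open import Tactic.RingSolver.NonReflective (fromCommutativeRing K (λ _ → nothing))
    using (solve; _⊜_; _⊕_; ⊝_)
  open import Relation.Binary.Reasoning.Setoid setoid

  Δ^ : ℕ → (Carrier → Carrier) → Carrier → Carrier
  Δ^ m = Δ K (replicate m α)

  Periodic : (Carrier → Carrier) → Set (c ⊔ ℓ)
  Periodic G = ∀ y → G (y + α) ≈ G y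

  binomialSum : ℕ → ℕ → (Carrier → Carrier) → Carrier → Carrier
  binomialSum k n H x = sum {n} (λ i → coeff k (toℕ i) * H (x + toℕ i × α))

  -- Any range n > k works; quantifying over n lets the inductive step shift the
  -- summation index without splitting off a last term.
  Δ^-expansion : ∀ {H} → Congruent₁ H → ∀ k n → k < n → ∀ x → Δ^ k H x ≈ binomialSum k n H x
  Δ^-expansion {H} H-cong zero (suc n) _ x = sym (begin
    1# * H (x + 0#) + sum {n} (λ i → 0# * H (x + suc (toℕ i) × α))
      ≈⟨ +-cong (*-identityˡ _) (sum-cong-≋ {n} (λ i → zeroˡ _)) ⟩
    H (x + 0#) + sum {n} (λ _ → 0#)
      ≈⟨ +-cong (H-cong (+-identityʳ x)) (sum-replicate-zero n) ⟩
    H x + 0#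
      ≈⟨ +-identityʳ (H x) ⟩
    H x ∎)
  Δ^-expansion {H} H-cong (suc k) (suc n) (s≤s k<n) x = begin
    Δ^ k H (x + α) - Δ^ k H x
      ≈⟨ //-cong₂ (Δ^-expansion H-cong k n k<n (x + α))
                  (Δ^-expansion H-cong k (suc n) (ℕ.m<n⇒m<1+n k<n) x) ⟩
    sum shifted - (coeff k 0 * H (x + 0#) + sum next)
      ≈⟨ solve 3 (λ a b c → (a ⊕ ⊝ (b ⊕ c)) ⊜ (⊝ b ⊕ (a ⊕ ⊝ c))) refl _ _ _ ⟩
    - (coeff k 0 * H (x + 0#)) + (sum shifted - sum next)
      ≈⟨ +-cong (-‿distribˡ-* _ _)
                (trans (//-cong₂ (sum-cong-≋ shifted≈) refl) (sym (∑[f-g]≈∑f-∑g current next))) ⟩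
    - coeff k 0 * H (x + 0#) + sum (λ i → current i - next i)
      ≈⟨ +-congˡ (sum-cong-≋ (λ i → sym ([y-z]x≈yx-zx (h i) _ _))) ⟩
    binomialSum (suc k) (suc n) H x ∎
    where
    h shifted current next : Fin n → Carrier
    h i = H (x + suc (toℕ i) × α)
    shifted i = coeff k (toℕ i) * H ((x + α) + toℕ i × α)
    current i = coeff k (toℕ i) * h i
    next i = coeff k (suc (toℕ i)) * h i
    shifted≈ : ∀ i → shifted i ≈ current i
    shifted≈ i = *-congˡ (H-cong (+-assoc x α _))

  Δ^-suc : ∀ m {G} → Congruent₁ G → ∀ y → Δ^ (suc m) G y ≈ Δ^ m (Δ K (α ∷ []) G) y
  Δ^-suc m = Δ-comm α (replicate m α)

  Δ-multiple : ∀ j {H} → Congruent₁ H → Periodic (Δ K (α ∷ []) H) →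
               ∀ x → Δ K (j × α ∷ []) H x ≈ j × Δ K (α ∷ []) H x
  Δ-multiple zero    {H} H-cong _        x = trans (+-congʳ (H-cong (+-identityʳ x))) (-‿inverseʳ (H x))
  Δ-multiple (suc j) {H} H-cong periodic x = begin
    H (x + (α + j × α)) - H x
      ≈⟨ +-congʳ (H-cong (sym (+-assoc x α _))) ⟩
    H ((x + α) + j × α) - H x
      ≈⟨ [a-b]+[b-c]≈a-c _ (H (x + α)) _ ⟨
    (H ((x + α) + j × α) - H (x + α)) + (H (x + α) - H x)
      ≈⟨ +-congʳ (Δ-multiple j H-cong periodic (x + α)) ⟩
    j × Δ K (α ∷ []) H (x + α) + Δ K (α ∷ []) H x
      ≈⟨ +-congʳ (×-congʳ j (periodic x)) ⟩
    j × Δ K (α ∷ []) H x + Δ K (α ∷ []) H x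
      ≈⟨ +-comm _ _ ⟩
    suc j × Δ K (α ∷ []) H x ∎

  Δ-multiples : ∀ js {G} → Congruent₁ G → Periodic (Δ^ (length js) G) →
                ∀ x → Δ K (map (_× α) js) G x ≈ product js × Δ^ (length js) G x
  Δ-multiples []       {G} _      _        x = sym (+-identityʳ (G x))
  Δ-multiples (j ∷ js) {G} G-cong periodic x = begin
    Δ K (j × α ∷ []) H x                  ≈⟨ Δ-multiple j (Δ-cong (map (_× α) js) G-cong)
                                                          increment-periodic x ⟩
    j × Δ K (α ∷ []) H x                  ≈⟨ ×-congʳ j (increment x) ⟩
    j × (product js × Δ^ (suc m) G x)     ≈⟨ ×-assocˡ _ j (product js) ⟩
    (j ℕ.* product js) × Δ^ (suc m) G x   ∎
    where
    m = length js
    H = Δ K (map (_× α) js) G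
    periodic′ : Periodic (Δ^ m (Δ K (α ∷ []) G))
    periodic′ y = trans (sym (Δ^-suc m G-cong (y + α))) (trans (periodic y) (Δ^-suc m G-cong y))
    increment : ∀ y → Δ K (α ∷ []) H y ≈ product js × Δ^ (suc m) G y
    increment y = begin
      Δ K (α ∷ map (_× α) js) G y              ≈⟨ Δ-comm α (map (_× α) js) G-cong y ⟩
      Δ K (map (_× α) js) (Δ K (α ∷ []) G) y   ≈⟨ Δ-multiples js (Δ-cong (α ∷ []) G-cong) periodic′ y ⟩
      product js × Δ^ m (Δ K (α ∷ []) G) y     ≈⟨ ×-congʳ (product js) (Δ^-suc m G-cong y) ⟨
      product js × Δ^ (suc m) G y              ∎
    increment-periodic : Periodic (Δ K (α ∷ []) H)
    increment-periodic y =
      trans (increment (y + α)) (trans (×-congʳ (product js) (periodic y)) (sym (increment y)))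

  module _ {k : ℕ} (p-prime : Prime (2 ℕ.+ k)) (char : (2 ℕ.+ k) × 1# ≈ 0#) where
    open PrimeCharacteristic K using (p×x≈0; ×-cancel; wilson)

    private
      p : ℕ
      p = 2 ℕ.+ k

    coeff-vanishes : ∀ {i} → 0 < i → i < p → coeff p i ≈ 0#
    coeff-vanishes {suc i} 0<i i<p =
      ×-cancel p-prime char 0<i i<p (trans (coeff-absorption (suc k) i) (p×x≈0 p-prime char _))

    Δ^p≈0 : ∀ {H} → Congruent₁ H → ∀ x → Δ^ p H x ≈ 0#
    Δ^p≈0 {H} H-cong x = begin
      Δ^ p H x                               ≈⟨ Δ^-expansion H-cong p (suc p) ℕ.≤-refl x ⟩
      binomialSum p (suc p) H x              ≈⟨ sum-cong-≋ collapse ⟩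
      binomialSum p (suc p) (λ _ → H x) x    ≈⟨ Δ^-expansion (λ _ → refl) p (suc p) ℕ.≤-refl x ⟨
      Δ^ p (λ _ → H x) x                     ≈⟨ Δ-const α (replicate (p ∸ 1) α) (H x) x ⟩
      0#                                     ∎
      where
      vanishing : ∀ {a b c} → c ≈ 0# → c * a ≈ c * b
      vanishing c≈0 = trans (*-congʳ c≈0) (trans (zeroˡ _) (sym (trans (*-congʳ c≈0) (zeroˡ _))))
      -- Only the terms i = 0 and i = p survive, and for those x + i α ≈ x.
      collapse : ∀ (i : Fin (suc p)) → coeff p (toℕ i) * H (x + toℕ i × α) ≈ coeff p (toℕ i) * H x
      collapse Fin.zero    = *-congˡ (H-cong (+-identityʳ x))
      collapse (Fin.suc i) with ℕ.m≤n⇒m<n∨m≡n (toℕ<n i)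
      ... | inj₁ i+1<p = vanishing (coeff-vanishes (s≤s z≤n) i+1<p)
      ... | inj₂ i+1≡p = *-congˡ (H-cong (trans (+-congˡ (trans (×-congˡ i+1≡p) (p×x≈0 p-prime char α)))
                                                (+-identityʳ x)))

    Δ^-periodic : ∀ {H} → Congruent₁ H → Periodic (Δ^ (p ∸ 1) H)
    Δ^-periodic H-cong y = x∙y⁻¹≈ε⇒x≈y _ _ (Δ^p≈0 H-cong y)

    Δ-nonzero-multiples : IsField K → Decidable _≈_ → ∀ {H} → Congruent₁ H →
                          ∀ x → Δ K (map (_× α) (applyUpTo suc (p ∸ 1))) H x ≈ - Δ^ (p ∸ 1) H x
    Δ-nonzero-multiples isField _≟_ {H} H-cong x = begin
      Δ K (map (_× α) js) H x                   ≈⟨ Δ-multiples js H-cong periodic x ⟩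
      product js × Δ^ (length js) H x           ≡⟨ ≡.cong₂ (λ a m → a × Δ^ m H x)
                                                     (product-applyUpTo-suc (p ∸ 1)) (length-applyUpTo suc (p ∸ 1)) ⟩
      ((p ∸ 1) !) × Δ^ (p ∸ 1) H x              ≈⟨ n×x≈[n×1]*x ((p ∸ 1) !) _ ⟩
      (((p ∸ 1) !) × 1#) * Δ^ (p ∸ 1) H x       ≈⟨ *-congʳ (wilson p-prime char isField _≟_) ⟩
      - 1# * Δ^ (p ∸ 1) H x                     ≈⟨ -1*x≈-x _ ⟩
      - Δ^ (p ∸ 1) H x                          ∎
      where
      js = applyUpTo suc (p ∸ 1)
      periodic : Periodic (Δ^ (length js) H)
      periodic = ≡.subst (λ m → Periodic (Δ^ m H)) (≡.sym (length-applyUpTo suc (p ∸ 1)))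
                         (Δ^-periodic H-cong)

lemma1 : ∀ {c ℓ : Level} (p n : ℕ) → Prime p → n ≥ 1 →
         (K : CommutativeRing c ℓ) → IsField K → HasCardinality K (p ^ n) →
         (F : CommutativeRing.Carrier K → CommutativeRing.Carrier K) →
         (∀ {x y} → CommutativeRing._≈_ K x y → CommutativeRing._≈_ K (F x) (F y)) →
         (α x : CommutativeRing.Carrier K) →
         CommutativeRing._≈_ K
           (Δ K (replicate (p ∸ 1) α) F x)
           (CommutativeRing.-_ K (Δ K (map (λ i → _·_ K (suc i) α) (upTo (p ∸ 1))) F x))
lemma1 zero          _ p-prime = ⊥-elim (ℕ.NonZero.nonZero (prime⇒nonZero p-prime))
lemma1 (suc zero)    _ p-prime = ⊥-elim (ℕ.NonTrivial.nonTrivial (prime⇒nonTrivial p-prime))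
lemma1 (suc (suc k)) n p-prime _ K isField card F F-cong α x = begin
  Δ^ (suc k) F x                                           ≈⟨ -‿involutive _ ⟨
  - - Δ^ (suc k) F x                                       ≈⟨ -‿cong (Δ-nonzero-multiples p-prime char isField
                                                                        card⇒decidable F-cong x) ⟨
  - Δ K (map (_× α) (applyUpTo suc (suc k))) F x           ≡⟨ ≡.cong (λ as → - Δ K as F x) multiples-of-α ⟨
  - Δ K (map (λ i → _·_ K (suc i) α) (upTo (suc k))) F x   ∎
  where
  open CommutativeRing K hiding (zero)
  open NaturalMultiples K using (_×_; ·≡×)
  open CardinalityFacts K card using (card⇒decidable; card-annihilates)
  open FieldFacts K isField card⇒decidable using ([m^n]×1≈0⇒m×1≈0)
  open IteratedDifferences K α using (Δ^; Δ-nonzero-multiples)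
  open import Algebra.Properties.Ring ring using (-‿involutive)
  open import Relation.Binary.Reasoning.Setoid setoid
  char : (2 ℕ.+ k) × 1# ≈ 0#
  char = [m^n]×1≈0⇒m×1≈0 (2 ℕ.+ k) n (card-annihilates 1#)
  multiples-of-α : map (λ i → _·_ K (suc i) α) (upTo (suc k)) ≡ map (_× α) (applyUpTo suc (suc k))
  multiples-of-α = ≡.trans (map-cong (λ i → ·≡× (suc i) α) (upTo (suc k)))
    (≡.trans (map-upTo _ (suc k)) (≡.sym (map-applyUpTo suc (_× α) (suc k))))
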